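{- Let $G$ be a finite connected graph of diameter $D(G) \geq 4$. Then $c(G) \leq \alpha(G)-1$, where $c(G)$ is the cop number of $G$ and $\alpha(G)$ is the independence number of $G$.
   Context: The game of Cops and Robbers on a finite undirected graph $G$: one player controls $k$ cops and the other a single robber. First the cops choose starting vertices (several cops may share a vertex), then the robber chooses a starting vertex. Players then alternate turns, beginning with the cops; on the cops' turn each cop moves to a vertex at distance at most $1$ from its current vertex, and on the robber's turn the robber does likewise. The cops win if at some point the robber occupies the same vertex as some cop; otherwise the robber wins. The cop number $c(G)$ is the minimum $k$ such that $k$ cops have a winning strategy. $\alpha(G)$ is the maximum size of an independent set of $G$, and $D(G)$ is the diameter (maximum distance between two vertices) of $G$. -}

module Defs where

open import Data.Nat using (ℕ; zero; suc; _≤_)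
open import Data.Fin using (Fin)
open import Data.Fin.Subset using (Subset; _∈_; ∣_∣)
open import Data.Product using (Σ; ∃; ∃-syntax; _×_; _,_)
open import Data.Sum using (_⊎_)
open import Relation.Nullary using (¬_; Dec)
open import Relation.Binary.PropositionalEquality using (_≡_)

record Graph : Set₁ where
  field
    n      : ℕ
    Adj    : Fin n → Fin n → Set
    sym    : ∀ {u v} → Adj u v → Adj v u
    irrefl : ∀ {u} → ¬ Adj u u
    adj?   : ∀ u v → Dec (Adj u v)

  V : Set
  V = Fin n

open Graph public

data Walk (G : Graph) : V G → V G → ℕ → Set where
  here : ∀ {u} → Walk G u u zero
  step : ∀ {u w v l} → Adj G u w → Walk G w v l → Walk G u v (suc l)

Connected : Graph → Set
Connected G = ∀ (u v : V G) → ∃[ l ] Walk G u v l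

Dist : (G : Graph) → V G → V G → ℕ → Set
Dist G u v d = Walk G u v d × (∀ l → Walk G u v l → d ≤ l)

IsDiameter : Graph → ℕ → Set
IsDiameter G D = (∃[ u ] ∃[ v ] Dist G u v D)
               × (∀ u v d → Dist G u v d → d ≤ D)

Independent : (G : Graph) → Subset (n G) → Set
Independent G S = ∀ u v → u ∈ S → v ∈ S → ¬ Adj G u v

IsIndependenceNumber : Graph → ℕ → Set
IsIndependenceNumber G a = (∃[ S ] (Independent G S × ∣ S ∣ ≡ a))
                         × (∀ S → Independent G S → ∣ S ∣ ≤ a)

Move : (G : Graph) → V G → V G → Set
Move G u v = u ≡ v ⊎ Adj G u v

Cops : Graph → ℕ → Set
Cops G k = Fin k → V G

Caught : (G : Graph) {k : ℕ} → Cops G k → V G → Set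
Caught G c r = ∃[ i ] c i ≡ r

-- Positions from which the cops can force a capture (the winning region of
-- this reachability game, built inductively).
mutual
  data CopsWinCopTurn (G : Graph) {k : ℕ} : Cops G k → V G → Set where
    caughtC : ∀ {c r} → Caught G c r → CopsWinCopTurn G c r
    moveC   : ∀ {c r} (c' : Cops G k) → (∀ i → Move G (c i) (c' i))
            → CopsWinRobTurn G c' r → CopsWinCopTurn G c r

  data CopsWinRobTurn (G : Graph) {k : ℕ} : Cops G k → V G → Set where
    caughtR : ∀ {c r} → Caught G c r → CopsWinRobTurn G c r
    moveR   : ∀ {c r} → (∀ r' → Move G r r' → CopsWinCopTurn G c r')
            → CopsWinRobTurn G c r

CopsWin : Graph → ℕ → Set
CopsWin G k = ∃[ c ] ∀ (r : V G) → CopsWinCopTurn G {k} c r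

-- Take x, y at distance D ≥ 4 and extend {x, y} greedily to a maximal, hence
-- dominating, independent set L ∪ {x, y}; it has at most α(G) elements. Put one
-- cop on each vertex of L and one chaser on x. A robber entering N[L] is caught
-- by a guard at once. Otherwise the robber starts in N[x] or N[y], say N[t], and
-- can never leave N[t]: one robber step from N[t] cannot reach N[o] for the other
-- endpoint o, as that would give a walk of length at most 3 from x to y. So the
-- chaser walks to t and then captures the robber inside N[t]. That is
-- |L| + 1 ≤ α(G) - 1 cops.
module Submission where

open import Defs
open import Data.Nat using (ℕ; _≤_; _∸_; _+_; suc; s≤s; z≤n)
open import Data.Nat.Properties using (≤-trans; ≤-refl; +-comm; ∸-monoˡ-≤; <⇒≱; m≤n⇒m≤1+n)
open import Data.Product using (∃-syntax; _×_; _,_; proj₂)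
open import Data.Sum using (_⊎_; inj₁; inj₂; [_,_]′; map₁; swap)
open import Data.Empty using (⊥-elim)
open import Data.Fin using (Fin; zero; suc; _≟_)
open import Data.Fin.Subset using (Subset; ⁅_⁆; _∪_; ∣_∣) renaming (_∈_ to _∈ₛ_; ⊥ to ∅)
open import Data.Fin.Subset.Properties using (∉⊥; x∈p∪q⁻; x∈p∪q⁺; x∈⁅y⁆⇒x≡y; x∈⁅x⁆; p⊂q⇒∣p∣<∣q∣; q⊆p∪q)
open import Data.List using (List; []; _∷_; _++_; length; lookup; allFin)
open import Data.List.Properties using (length-++)
open import Data.List.Relation.Unary.Any as Any using (Any; here; there; any?)
open import Data.List.Relation.Unary.Any.Properties using (lookup-index; ++⁻)
open import Data.List.Relation.Unary.All as All using ([]; _∷_)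
open import Data.List.Relation.Unary.All.Properties.Core using (¬Any⇒All¬)
open import Data.List.Relation.Unary.AllPairs as AllPairs using (AllPairs; []; _∷_)
open import Data.List.Relation.Unary.Unique.Propositional using (Unique)
open import Data.List.Membership.Propositional using (_∈_)
open import Data.List.Membership.Propositional.Properties using (∈-allFin)
open import Data.Vec.Functional using (updateAt) renaming (_∷_ to _◂_)
open import Data.Vec.Functional.Properties using (updateAt-updates; updateAt-minimal)
open import Function using (const; _∘_)
open import Relation.Nullary using (¬_; Dec; yes; no)
open import Relation.Nullary.Decidable.Core using (_⊎-dec_)
open import Relation.Binary.PropositionalEquality using (_≡_; refl; trans; subst) renaming (sym to ≡-sym)

fromList : ∀ {n} → List (Fin n) → Subset n
fromList []      = ∅
fromList (v ∷ M) = ⁅ v ⁆ ∪ fromList M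

∈-fromList⁻ : ∀ {n} {u : Fin n} M → u ∈ₛ fromList M → u ∈ M
∈-fromList⁻ []      u∈ = ⊥-elim (∉⊥ u∈)
∈-fromList⁻ (v ∷ M) u∈ with x∈p∪q⁻ ⁅ v ⁆ (fromList M) u∈
... | inj₁ u∈v = here (x∈⁅y⁆⇒x≡y v u∈v)
... | inj₂ u∈M = there (∈-fromList⁻ M u∈M)

length≤∣fromList∣ : ∀ {n} {M : List (Fin n)} → Unique M → length M ≤ ∣ fromList M ∣
length≤∣fromList∣ {M = []}    []          = z≤n
length≤∣fromList∣ {M = v ∷ M} (v∉M ∷ uM) =
  ≤-trans (s≤s (length≤∣fromList∣ uM))
          (p⊂q⇒∣p∣<∣q∣ (q⊆p∪q ⁅ v ⁆ (fromList M) , v , x∈p∪q⁺ (inj₁ (x∈⁅x⁆ v)) ,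
                        λ v∈M → All.lookup v∉M (∈-fromList⁻ M v∈M) refl))

module _ {G : Graph} where

  Move? : ∀ u v → Dec (Move G u v)
  Move? u v = (u ≟ v) ⊎-dec adj? G u v

  Move-sym : ∀ {u v} → Move G u v → Move G v u
  Move-sym (inj₁ refl) = inj₁ refl
  Move-sym (inj₂ uv)   = inj₂ (sym G uv)

  WalkWithin : V G → V G → ℕ → Set
  WalkWithin u v m = ∃[ l ] (l ≤ m × Walk G u v l)

  walkWithin-move : ∀ {u w v m} → Move G u w → WalkWithin w v m → WalkWithin u v (suc m)
  walkWithin-move (inj₁ refl) (l , l≤m , p) = l , m≤n⇒m≤1+n l≤m , p
  walkWithin-move (inj₂ uw)   (l , l≤m , p) = suc l , s≤s l≤m , step uw p

  Far : V G → V G → Set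
  Far t o = ∀ {r r'} → Move G t r → Move G r r' → ¬ Move G o r'

  Far-sym : ∀ {t o} → Far t o → Far o t
  Far-sym far or rr' tr' = far tr' (Move-sym rr') or

  dist≥4⇒Far : ∀ {x y D} → Dist G x y D → 4 ≤ D → Far x y
  dist≥4⇒Far (_ , shortest) 4≤D xr rr' yr'
    with walkWithin-move xr (walkWithin-move rr' (walkWithin-move (Move-sym yr') (0 , ≤-refl , here)))
  ... | l , l≤3 , p = <⇒≱ ≤-refl (≤-trans 4≤D (≤-trans (shortest l p) l≤3))

  Dominated : List (V G) → V G → Set
  Dominated M v = Any (λ w → Move G w v) M

  IndependentList : List (V G) → Set
  IndependentList = AllPairs (λ u v → ¬ Move G u v)

  IndependentList⇒Unique : ∀ {M} → IndependentList M → Unique M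
  IndependentList⇒Unique = AllPairs.map (λ ¬uv u≡v → ¬uv (inj₁ u≡v))

  IndependentList⇒¬Adj : ∀ {M u v} → IndependentList M → u ∈ M → v ∈ M → ¬ Adj G u v
  IndependentList⇒¬Adj (_   ∷ _)  (here refl) (here refl) = irrefl G
  IndependentList⇒¬Adj (u↮M ∷ _)  (here refl) (there v∈M) uv = All.lookup u↮M v∈M (inj₂ uv)
  IndependentList⇒¬Adj (v↮M ∷ _)  (there u∈M) (here refl) uv = All.lookup v↮M u∈M (inj₂ (sym G uv))
  IndependentList⇒¬Adj (_   ∷ iM) (there u∈M) (there v∈M)    = IndependentList⇒¬Adj iM u∈M v∈M

  IndependentList⇒length≤α : ∀ {M a} → IsIndependenceNumber G a → IndependentList M → length M ≤ a
  IndependentList⇒length≤α {M} (_ , maximum) iM =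
    ≤-trans (length≤∣fromList∣ (IndependentList⇒Unique iM))
            (maximum (fromList M) λ u v u∈ v∈ →
              IndependentList⇒¬Adj iM (∈-fromList⁻ M u∈) (∈-fromList⁻ M v∈))

  extendIndependent : ∀ {I} → IndependentList I → (vs : List (V G)) →
                      ∃[ L ] (IndependentList (L ++ I) × (∀ {v} → v ∈ vs → Dominated (L ++ I) v))
  extendIndependent iI [] = [] , iI , λ ()
  extendIndependent {I} iI (u ∷ vs) with extendIndependent iI vs
  ... | L , iLI , domL with any? (λ w → Move? w u) (L ++ I)
  ...   | yes u-dom = L , iLI , λ { (here refl) → u-dom ; (there v∈) → domL v∈ }
  ...   | no  u-free =
          u ∷ L , All.map (λ ¬wu uw → ¬wu (Move-sym uw)) (¬Any⇒All¬ _ u-free) ∷ iLI ,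
          λ { (here refl) → here (inj₁ refl) ; (there v∈) → there (domL v∈) }

  maximalIndependentExtension : ∀ {I} → IndependentList I →
                                ∃[ L ] (IndependentList (L ++ I) × (∀ v → Dominated (L ++ I) v))
  maximalIndependentExtension iI with extendIndependent iI (allFin (n G))
  ... | L , iLI , dom = L , iLI , λ v → dom (∈-allFin v)

  catchAdjacent : ∀ {k} (c : Cops G k) {r} i → Move G (c i) r → CopsWinCopTurn G c r
  catchAdjacent c {r} i cr = moveC c' moves (caughtR (i , updateAt-updates i c))
    where
    c' : Cops G _
    c' = updateAt c i (const r)
    moves : ∀ j → Move G (c j) (c' j)
    moves j with j ≟ i
    ... | yes refl = subst (Move G (c i)) (≡-sym (updateAt-updates i c)) cr
    ... | no  j≢i  = inj₁ (≡-sym (updateAt-minimal j i c j≢i))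

  moveHead : ∀ {k p q} (cs : Cops G k) → Adj G p q → ∀ j → Move G ((p ◂ cs) j) ((q ◂ cs) j)
  moveHead cs pq zero    = inj₂ pq
  moveHead cs pq (suc j) = inj₁ refl

  module GuardsAndChaser (L : List (V G)) where

    chaserAndGuards : V G → Cops G (suc (length L))
    chaserAndGuards p = p ◂ lookup L

    guardCatches : ∀ p {r} → Dominated L r → CopsWinCopTurn G (chaserAndGuards p) r
    guardCatches p g = catchAdjacent (chaserAndGuards p) (suc (Any.index g)) (lookup-index g)

    Trapped : V G → Set
    Trapped t = ∀ {r r'} → Move G t r → Move G r r' → Move G t r' ⊎ Dominated L r'

    far⇒Trapped : ∀ {t o} → Far t o → (∀ v → (Move G t v ⊎ Move G o v) ⊎ Dominated L v) → Trapped t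
    far⇒Trapped far dom tr rr' with dom _
    ... | inj₁ (inj₁ tr') = inj₁ tr'
    ... | inj₁ (inj₂ or') = ⊥-elim (far tr rr' or')
    ... | inj₂ g          = inj₂ g

    chase : ∀ {t} → Trapped t → ∀ {p l} → Walk G p t l → ∀ r → Move G t r → CopsWinCopTurn G (chaserAndGuards p) r
    chase trapped here          r tr = catchAdjacent (chaserAndGuards _) zero tr
    chase trapped (step {w = q} pq walk) r tr =
      moveC (chaserAndGuards q) (moveHead (lookup L) pq)
        (moveR λ r' rr' → [ chase trapped walk r' , guardCatches q ]′ (trapped tr rr'))

    guardsAndChaserWin : Connected G → ∀ {x y} → Far x y →
                         (∀ v → (Move G x v ⊎ Move G y v) ⊎ Dominated L v) → CopsWin G (suc (length L))
    guardsAndChaserWin conn {x} {y} far dom = chaserAndGuards x , start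
      where
      start : ∀ r → CopsWinCopTurn G (chaserAndGuards x) r
      start r with dom r
      ... | inj₁ (inj₁ xr) = chase (far⇒Trapped far dom) here r xr
      ... | inj₁ (inj₂ yr) = chase (far⇒Trapped (Far-sym far) (map₁ swap ∘ dom)) (proj₂ (conn x y)) r yr
      ... | inj₂ g         = guardCatches x g

  Far⇒IndependentPair : ∀ {x y} → Far x y → IndependentList (x ∷ y ∷ [])
  Far⇒IndependentPair far = ((λ xy → far xy (inj₁ refl) (inj₁ refl)) ∷ []) ∷ [] ∷ []

  Far⇒CopsWin : Connected G → ∀ {a} → IsIndependenceNumber G a → ∀ {x y} → Far x y →
                ∃[ k ] (k ≤ a ∸ 1 × CopsWin G k)
  Far⇒CopsWin conn {a} α {x} {y} far with maximalIndependentExtension (Far⇒IndependentPair far)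
  ... | L , independent , dominating =
        suc (length L) , ∸-monoˡ-≤ 1 2+|L|≤a , GuardsAndChaser.guardsAndChaserWin L conn far dom
    where
    2+|L|≤a : 2 + length L ≤ a
    2+|L|≤a = subst (_≤ a) (trans (length-++ L) (+-comm (length L) 2))
                    (IndependentList⇒length≤α α independent)

    dom : ∀ v → (Move G x v ⊎ Move G y v) ⊎ Dominated L v
    dom v with ++⁻ L (dominating v)
    ... | inj₁ g                 = inj₂ g
    ... | inj₂ (here xv)         = inj₁ (inj₁ xv)
    ... | inj₂ (there (here yv)) = inj₁ (inj₂ yv)

theorem1 : (G : Graph) → Connected G → (D : ℕ) → IsDiameter G D → 4 ≤ D → (a : ℕ) → IsIndependenceNumber G a → ∃[ k ] (k ≤ a ∸ 1 × CopsWin G k)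
theorem1 G conn D ((x , y , xy-dist) , _) 4≤D a α = Far⇒CopsWin conn α (dist≥4⇒Far xy-dist 4≤D)
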